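{- For every atomic command $\mathsf{c}$ and all sets of states $P$, $Q$: if both the IL triple $[P]\,\mathsf{c}\,[Q]$ and the SIL triple $\langle P\rangle\,\mathsf{c}\,\langle Q\rangle$ are valid, then $P\land\overleftarrow{[\![\mathsf{c}]\!]}Q = P$ and $Q\land[\![\mathsf{c}]\!]P=Q$.
   Context: Atomic commands are $\mathsf{c} ::= \mathtt{skip} \mid x:=a \mid b? \mid x:=\mathtt{nondet()}$, acting on stores $\sigma:\mathrm{Var}\to\mathbb{Z}$ (possibly tagged with a flag ok/er, error-tagged states being left unchanged). Forward semantics: $[\![\mathtt{skip}]\!]\sigma=\{\sigma\}$, $[\![x:=a]\!]\sigma=\{\sigma[x\mapsto[\![a]\!]\sigma]\}$, $[\![b?]\!]\sigma=\{\sigma\}$ if $b$ holds in $\sigma$ and $\varnothing$ otherwise, $[\![x:=\mathtt{nondet()}]\!]\sigma=\{\sigma[x\mapsto v]\mid v\in\mathbb{Z}\}$, lifted to sets by union. Backward semantics: $\overleftarrow{[\![\mathsf{c}]\!]}\sigma'=\{\sigma\mid\sigma'\in[\![\mathsf{c}]\!]\sigma\}$, lifted by union. $\land$ denotes intersection of sets of states. The IL triple $[P]\,\mathsf{c}\,[Q]$ is valid iff $Q\subseteq[\![\mathsf{c}]\!]P$; the SIL triple $\langle P\rangle\,\mathsf{c}\,\langle Q\rangle$ is valid iff $P\subseteq\overleftarrow{[\![\mathsf{c}]\!]}Q$. -}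

module Defs where

open import Data.Nat using (ℕ)
open import Data.Integer using (ℤ; _+_; _*_; -_; _≤_)
open import Data.Product using (Σ; ∃; _×_; _,_)
open import Relation.Binary.PropositionalEquality using (_≡_)
open import Relation.Nullary using (¬_)
open import Data.Sum using (_⊎_)
import Data.Nat
import Data.Sum
import Relation.Nullary

Var : Set
Var = ℕ

Store : Set
Store = Var → ℤ

_[_↦_] : Store → Var → ℤ → Store
(σ [ x ↦ v ]) y with Data.Nat._≟_ y x
... | Relation.Nullary.yes _ = v
... | Relation.Nullary.no _ = σ y

data AExp : Set where
  num  : ℤ → AExp
  var  : Var → AExp
  plus : AExp → AExp → AExp
  times : AExp → AExp → AExp
  neg  : AExp → AExp

⟦_⟧a : AExp → Store → ℤ
⟦ num n ⟧a σ = n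
⟦ var x ⟧a σ = σ x
⟦ plus a b ⟧a σ = ⟦ a ⟧a σ + ⟦ b ⟧a σ
⟦ times a b ⟧a σ = ⟦ a ⟧a σ * ⟦ b ⟧a σ
⟦ neg a ⟧a σ = - ⟦ a ⟧a σ

data BExp : Set where
  tt  : BExp
  ff  : BExp
  eq  : AExp → AExp → BExp
  leq : AExp → AExp → BExp
  not : BExp → BExp
  and : BExp → BExp → BExp
  or  : BExp → BExp → BExp

data ⊤' : Set where
  ∙ : ⊤'
data ⊥' : Set where

⟦_⟧b : BExp → Store → Set
⟦ tt ⟧b σ = ⊤'
⟦ ff ⟧b σ = ⊥'
⟦ eq a b ⟧b σ = ⟦ a ⟧a σ ≡ ⟦ b ⟧a σ
⟦ leq a b ⟧b σ = ⟦ a ⟧a σ ≤ ⟦ b ⟧a σ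
⟦ not b ⟧b σ = ¬ ⟦ b ⟧b σ
⟦ and b c ⟧b σ = ⟦ b ⟧b σ × ⟦ c ⟧b σ
⟦ or b c ⟧b σ = Data.Sum._⊎_ (⟦ b ⟧b σ) (⟦ c ⟧b σ)

data Flag : Set where
  ok er : Flag

State : Set
State = Flag × Store

data Atom : Set where
  skip   : Atom
  assign : Var → AExp → Atom
  assume : BExp → Atom
  nondet : Var → Atom

-- Forward semantics as a relation: Step c s s' means s' ∈ ⟦ c ⟧ {s}.
-- Error-tagged states are left unchanged.
data Step : Atom → State → State → Set where
  er-skip : ∀ {c σ} → Step c (er , σ) (er , σ)
  s-skip  : ∀ {σ} → Step skip (ok , σ) (ok , σ)
  s-assign : ∀ {x a σ} → Step (assign x a) (ok , σ) (ok , σ [ x ↦ ⟦ a ⟧a σ ])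
  s-assume : ∀ {b σ} → ⟦ b ⟧b σ → Step (assume b) (ok , σ) (ok , σ)
  s-nondet : ∀ {x σ} (v : ℤ) → Step (nondet x) (ok , σ) (ok , σ [ x ↦ v ])

Pred : Set₁
Pred = State → Set

_⊆_ : Pred → Pred → Set
P ⊆ Q = ∀ s → P s → Q s

_≐_ : Pred → Pred → Set
P ≐ Q = (P ⊆ Q) × (Q ⊆ P)

_∧_ : Pred → Pred → Pred
(P ∧ Q) s = P s × Q s

-- forward collecting semantics ⟦ c ⟧ P = ⋃_{σ ∈ P} ⟦ c ⟧ σ
fwd : Atom → Pred → Pred
fwd c P s' = Σ State (λ s → P s × Step c s s')

-- backward semantics ⟦ c ⟧← Q = { σ | ∃ σ' ∈ Q. σ' ∈ ⟦ c ⟧ σ }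
bwd : Atom → Pred → Pred
bwd c Q s = Σ State (λ s' → Q s' × Step c s s')

IL : Pred → Atom → Pred → Set
IL P c Q = Q ⊆ fwd c P

SIL : Pred → Atom → Pred → Set
SIL P c Q = P ⊆ bwd c Q

{-# OPTIONS --safe #-}
module Submission where

open import Defs
open import Data.Product using (_×_; _,_; proj₁)

⊆⇒∧≐ : {P Q : Pred} → P ⊆ Q → (P ∧ Q) ≐ P
⊆⇒∧≐ P⊆Q = (λ _ → proj₁) , (λ s p → p , P⊆Q s p)

proposition3p5 : (c : Atom) (P Q : Pred) → IL P c Q → SIL P c Q → ((P ∧ bwd c Q) ≐ P) × ((Q ∧ fwd c P) ≐ Q)
proposition3p5 c P Q il sil = ⊆⇒∧≐ sil , ⊆⇒∧≐ il
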